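{- Let $S_1,\ldots,S_r\in\mathcal{S}$ and $\epsilon\ge 0$ be such that $x:=\frac{1}{r}\sum_{j'=1}^r\chi^{S_{j'}}$ satisfies $x(\delta(s))=x(\delta(t))=1$ and $x^*(F)-\epsilon\le x(F)\le x^*(F)+\epsilon$ for all $F\subseteq E$. Let $0\le h<i\le\ell$ and $1\le j\le r$ with $j\le\theta_h$ and $j\le\theta_i$, where $\theta_m:=\lceil r(2-x^*(C_m)-\epsilon)\rceil$. Let $M=U_i\setminus U_h$ or $M=U_i$. Then there exists an index $k\ge j$ such that $(V,S_k)[M]$ is connected.
   Context: $V$ is a finite set, $s,t\in V$ with $s\neq t$, and $E$ is the edge set of the complete graph on $V$. For $U\subseteq V$, $\delta(U)$ is the set of edges with exactly one endpoint in $U$, $\delta(v):=\delta(\{v\})$, and $E[U]$ is the set of edges with both endpoints in $U$. For $F\subseteq E$ and $U\subseteq V$, $(V,F)[U]$ denotes the graph $(U,F\cap E[U])$. For $x\in\mathbb{R}^E$ and $F\subseteq E$, $x(F):=\sum_{e\in F}x_e$; $\chi^F$ is the characteristic vector of $F$. $x^*$ is a fixed optimal solution of the LP: minimize $\sum_e c_ex_e$ (for a given metric $c$ on $V$) subject to $x(\delta(U))\ge 2$ for all $\emptyset\ne U\subsetneq V$ with $|U\cap\{s,t\}|$ even, $x(\delta(U))\ge 1$ for all $\emptyset\ne U\subsetneq V$ with $|U\cap\{s,t\}|$ odd, $x(\delta(v))=2$ for $v\in V\setminus\{s,t\}$, $x(\delta(v))=1$ for $v\in\{s,t\}$, $x\ge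 0$. $\mathcal{S}$ is the set of edge sets of spanning trees of $(V,E)$. A narrow cut is a cut $C=\delta(U)$ with $x^*(C)<2$. It is known that the narrow cuts form a chain: there are sets $\{s\}=U_0\subset U_1\subset\cdots\subset U_\ell=V\setminus\{t\}$ such that the narrow cuts are exactly $C_i:=\delta(U_i)$, $i=0,\ldots,\ell$; this numbering is used throughout. -}

module Defs where

open import Data.Nat as ℕ using (ℕ; zero; suc; _<ᵇ_)
open import Data.Integer as ℤ using (ℤ; +_; -[1+_])
open import Data.Fin as Fin using (Fin; toℕ; fromℕ; inject₁)
open import Data.Bool using (Bool; true; false; T; _∧_; _xor_; not; if_then_else_)
open import Data.List using (List; []; _∷_; foldr; map; filterᵇ; allFin; concatMap; length; _++_; [_])
open import Data.List.Relation.Unary.Unique.Propositional using (Unique)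
open import Data.Product using (Σ; _×_; _,_)
open import Data.Sum using (_⊎_)
open import Data.Unit using (⊤)
open import Relation.Nullary using (¬_)
open import Relation.Nullary.Decidable using (⌊_⌋)
open import Relation.Binary.PropositionalEquality using (_≡_; _≢_)
open import Algebra.Structures using (IsCommutativeRing)
open import Relation.Binary.Structures using (IsTotalOrder)

-- Scalars: an arbitrary (nontrivial) ordered field, with equality _≡_.
-- ℝ is an instance; the statement is proved for every such field.

record OrderedField : Set₁ where
  infixl 6 _+_
  infixl 7 _*_
  infix  4 _≤_
  field
    K       : Set
    _+_ _*_ : K → K → K
    -_      : K → K
    0# 1#   : K
    _⁻¹     : K → K
    _≤_     : K → K → Set
    isCommutativeRing : IsCommutativeRing _≡_ _+_ _*_ -_ 0# 1#
    0≢1      : 0# ≢ 1#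
    inverse  : ∀ a → a ≢ 0# → a * (a ⁻¹) ≡ 1#
    isTotalOrder : IsTotalOrder _≡_ _≤_
    +-monoˡ-≤ : ∀ a b c → a ≤ b → a + c ≤ b + c
    *-nonneg  : ∀ a b → 0# ≤ a → 0# ≤ b → 0# ≤ a * b

  infix 4 _<_
  _<_ : K → K → Set
  a < b = a ≤ b × a ≢ b

  infixl 6 _-_
  _-_ : K → K → K
  a - b = a + (- b)

  2# : K
  2# = 1# + 1#

  ιℕ : ℕ → K
  ιℕ zero    = 0#
  ιℕ (suc n) = 1# + ιℕ n

  ιℤ : ℤ → K
  ιℤ (+ n)      = ιℕ n
  ιℤ -[1+ n ]   = - ιℕ (suc n)

  sumK : List K → K
  sumK = foldr _+_ 0#

record CeilField : Set₁ where
  field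
    ordered : OrderedField
  open OrderedField ordered
  field
    ⌈_⌉      : K → ℤ
    ceil-lower : ∀ a → ιℤ ⌈ a ⌉ - 1# < a
    ceil-upper : ∀ a → a ≤ ιℤ ⌈ a ⌉
  open OrderedField ordered public

-- Complete graph on V = Fin n.
-- An edge {u,v} is represented by the ordered pair (u,v) with u < v;
-- an edge set is  Fin n → Fin n → Bool  (only values at u < v matter),
-- a vector in ℝ^E is  Fin n → Fin n → K  (only values at u < v matter).

VSet : ℕ → Set
VSet n = Fin n → Bool

EdgeSet : ℕ → Set
EdgeSet n = Fin n → Fin n → Bool

edges : (n : ℕ) → List (Fin n × Fin n)
edges n = filterᵇ (λ p → toℕ (Data.Product.proj₁ p) <ᵇ toℕ (Data.Product.proj₂ p))
                  (concatMap (λ u → map (λ v → (u , v)) (allFin n)) (allFin n))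

δ : ∀ {n} → VSet n → EdgeSet n
δ U u v = U u xor U v

Einside : ∀ {n} → VSet n → EdgeSet n
Einside U u v = U u ∧ U v

single : ∀ {n} → Fin n → VSet n
single s v = ⌊ v Fin.≟ s ⌋

NonEmpty : ∀ {n} → VSet n → Set
NonEmpty {n} U = Σ (Fin n) λ v → T (U v)

Proper : ∀ {n} → VSet n → Set
Proper {n} U = Σ (Fin n) λ v → ¬ T (U v)

_⊂_ : ∀ {n} → VSet n → VSet n → Set
_⊂_ {n} U W = (∀ v → T (U v) → T (W v)) × Σ (Fin n) λ v → T (W v) × ¬ T (U v)

SameEdges : ∀ {n} → EdgeSet n → EdgeSet n → Set
SameEdges {n} F G = ∀ (u v : Fin n) → toℕ u ℕ.< toℕ v → F u v ≡ G u v

Adj : ∀ {n} → EdgeSet n → Fin n → Fin n → Set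
Adj F u v = (toℕ u ℕ.< toℕ v × T (F u v)) ⊎ (toℕ v ℕ.< toℕ u × T (F v u))

data Walk {n} (F : EdgeSet n) (M : VSet n) : Fin n → Fin n → Set where
  here : ∀ {u} → T (M u) → Walk F M u u
  step : ∀ {u w v} → T (M u) → Adj F u w → Walk F M w v → Walk F M u v

Connected : ∀ {n} → EdgeSet n → VSet n → Set
Connected {n} F M = ∀ (u v : Fin n) → T (M u) → T (M v) → Walk F M u v

ConsecAdj : ∀ {n} → EdgeSet n → Fin n → List (Fin n) → Set
ConsecAdj F a []       = ⊤
ConsecAdj F a (b ∷ bs) = Adj F a b × ConsecAdj F b bs

HasCycle : ∀ {n} → EdgeSet n → Set
HasCycle {n} F = Σ (Fin n) λ v0 → Σ (List (Fin n)) λ vs →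
  2 ℕ.≤ length vs × Unique (v0 ∷ vs) × ConsecAdj F v0 (vs ++ [ v0 ])

allV : ∀ {n} → VSet n
allV v = true

IsSpanningTree : ∀ {n} → EdgeSet n → Set
IsSpanningTree F = Connected F allV × ¬ HasCycle F

module _ (𝔽 : OrderedField) where
  open OrderedField 𝔽

  Vec-E : ℕ → Set
  Vec-E n = Fin n → Fin n → K

  wt : ∀ {n} → Vec-E n → EdgeSet n → K
  wt {n} x F = sumK (map (λ p → if F (Data.Product.proj₁ p) (Data.Product.proj₂ p)
                                   then x (Data.Product.proj₁ p) (Data.Product.proj₂ p) else 0#)
                         (edges n))

  χ : ∀ {n} → EdgeSet n → Vec-E n
  χ F u v = if F u v then 1# else 0#

  avg : ∀ {n r} → (Fin r → EdgeSet n) → Vec-E n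
  avg {n} {r} S u v = (ιℕ r) ⁻¹ * sumK (map (λ j → χ (S j) u v) (allFin r))

  IsMetric : ∀ {n} → (Fin n → Fin n → K) → Set
  IsMetric {n} d = (∀ u → d u u ≡ 0#) × (∀ u v → d u v ≡ d v u)
                 × (∀ u v → 0# ≤ d u v) × (∀ u v w → d u w ≤ d u v + d v w)

  cost : ∀ {n} → (Fin n → Fin n → K) → Vec-E n → K
  cost {n} c x = sumK (map (λ p → c (Data.Product.proj₁ p) (Data.Product.proj₂ p)
                                 * x (Data.Product.proj₁ p) (Data.Product.proj₂ p)) (edges n))

  Feasible : ∀ {n} → Fin n → Fin n → Vec-E n → Set
  Feasible {n} s t x =
      (∀ (U : VSet n) → NonEmpty U → Proper U →
          (if U s xor U t then 1# else 2#) ≤ wt x (δ U))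
    × (∀ (v : Fin n) → v ≢ s → v ≢ t → wt x (δ (single v)) ≡ 2#)
    × wt x (δ (single s)) ≡ 1#
    × wt x (δ (single t)) ≡ 1#
    × (∀ (u v : Fin n) → toℕ u ℕ.< toℕ v → 0# ≤ x u v)

  Optimal : ∀ {n} → (Fin n → Fin n → K) → Fin n → Fin n → Vec-E n → Set
  Optimal {n} c s t x = Feasible s t x × (∀ y → Feasible s t y → cost c x ≤ cost c y)

  -- The narrow cuts of x* are exactly δ(U_0),…,δ(U_ℓ) with
  -- {s} = U_0 ⊂ U_1 ⊂ … ⊂ U_ℓ = V∖{t}.
  NarrowChain : ∀ {n} → Fin n → Fin n → Vec-E n → (ℓ : ℕ) → (Fin (suc ℓ) → VSet n) → Set
  NarrowChain {n} s t x ℓ U =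
      (∀ v → U Fin.zero v ≡ single s v)
    × (∀ v → U (fromℕ ℓ) v ≡ not (single t v))
    × (∀ (i : Fin ℓ) → U (inject₁ i) ⊂ U (Fin.suc i))
    × (∀ (W : VSet n) → NonEmpty W → Proper W →
          (wt x (δ W) < 2# → Σ (Fin (suc ℓ)) λ i → SameEdges (δ W) (δ (U i)))
        × ((Σ (Fin (suc ℓ)) λ i → SameEdges (δ W) (δ (U i))) → wt x (δ W) < 2#))

-- Suppose (V,S_k)[M] is disconnected for every k ≥ j. Each S_k[M] is a forest on m = |M| vertices,
-- so it has at most m − 1 edges, and at most m − 2 when k ≥ j; averaging over the r trees gives
-- r·x(E[M]) ≤ r(m − 2) + (j − 1). The degree constraints of x* give
-- 2x*(E[M]) = 2m − x*(δ(M)) − [s ∈ M], and x*(δ(M)) + [s ∈ M] is at most x*(C_h) + x*(C_i)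
-- for M = U_i ∖ U_h, and at most 2x*(C_i) for M = U_i (because x*(C_i) ≥ 1). With
-- x*(E[M]) ≤ x(E[M]) + ε this yields r(2 − x*(C_h) − ε) + r(2 − x*(C_i) − ε) ≤ 2(j − 1),
-- contradicting j ≤ θ_h and j ≤ θ_i.

module Submission where

open import Defs
open import Algebra.Bundles using (CommutativeRing; CommutativeSemiring)
open import Algebra.Structures using (IsCommutativeRing)
open import Data.Bool using (Bool; true; false; T; not; _∧_; _xor_; if_then_else_)
open import Data.Bool.Properties using (T-∧; T-≡; T-not-≡; ∧-zeroʳ; ∧-identityʳ)
open import Data.Empty using (⊥; ⊥-elim)
open import Data.Fin as Fin using (Fin; toℕ; inject₁)
import Data.Fin.Properties as Finₚ
open import Data.Fin.Induction using (<-weakInduction-startingFrom)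
open import Data.Integer as ℤ using (+_)
open import Data.List using (List; []; _∷_; _++_; [_]; map; filterᵇ; allFin; length; concatMap; cartesianProduct)
open import Data.List.Properties using (map-tabulate; length-removeAt′)
open import Data.List.Relation.Unary.All as All using (All; []; _∷_)
import Data.List.Relation.Unary.All.Properties as Allₚ
open import Data.List.Relation.Unary.Unique.Propositional using (Unique)
open import Data.List.Relation.Unary.AllPairs using ([]; _∷_)
open import Data.List.Relation.Unary.Any using (here; there; index)
open import Data.List.Membership.Propositional using (_∈_; _∉_; _─_)
open import Data.List.Membership.Propositional.Properties using (∈-filter⁺; ∈-allFin)
import Data.List.Relation.Unary.Unique.Propositional.Properties as Uniqueₚ
open import Data.Nat as ℕ using (ℕ; zero; suc)
import Data.Nat.Properties as ℕₚ
open import Data.Product using (Σ; _×_; _,_; proj₁; proj₂; uncurry)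
open import Data.Sum using (_⊎_; inj₁; inj₂; [_,_]′)
open import Function using (_∘_; Equivalence)
open import Algebra.Definitions.RawMonoid ℕ.+-0-rawMonoid using (sum)
open import Data.Nat.Tactic.RingSolver using (solve-∀)
open import Data.Unit using (tt)
open import Relation.Binary.Construct.Closure.ReflexiveTransitive as Star using (_◅_; _◅◅_)
open import Relation.Binary.Construct.Closure.Symmetric using (SymClosure; fwd; bwd)
open import Relation.Binary.Construct.Closure.Equivalence as Eq using (EqClosure)
open import Relation.Binary.Bundles using (Poset)
import Relation.Binary.Reasoning.PartialOrder
open import Relation.Binary.PropositionalEquality
  using (_≡_; _≢_; refl; sym; trans; cong; cong₂; subst; subst₂; module ≡-Reasoning)
open import Relation.Binary.Structures using (IsTotalOrder)
open import Relation.Nullary using (¬_; yes; no)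
open import Relation.Nullary.Decidable using (⌊_⌋; T?; fromWitness)

module OrderedFieldProperties (𝔽 : OrderedField) where
  open OrderedField 𝔽
  open IsCommutativeRing isCommutativeRing public
    using ( +-comm; +-assoc; +-identityˡ; +-identityʳ; -‿inverseˡ; -‿inverseʳ
          ; *-comm; *-assoc; *-identityˡ; *-identityʳ; distribˡ; distribʳ; zeroˡ; zeroʳ )
  open IsTotalOrder isTotalOrder public
    using (total; antisym) renaming (refl to ≤-refl; trans to ≤-trans; reflexive to ≤-reflexive)

  commutativeRing : CommutativeRing _ _
  commutativeRing = record { isCommutativeRing = isCommutativeRing }

  commutativeSemiring : CommutativeSemiring _ _
  commutativeSemiring = CommutativeRing.commutativeSemiring commutativeRing

  poset : Poset _ _ _
  poset = record { isPartialOrder = IsTotalOrder.isPartialOrder isTotalOrder }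

  open import Relation.Binary.Properties.Poset poset public using (≤⇒≯)
  module ≤-Reasoning = Relation.Binary.Reasoning.PartialOrder poset
  open import Algebra.Properties.Ring (CommutativeRing.ring commutativeRing) using (-1*x≈-x; -‿involutive)
  open import Algebra.Solver.Ring.NaturalCoefficients.Default commutativeSemiring

  a+b-b≡a : ∀ a b → a + b - b ≡ a
  a+b-b≡a a b = trans (+-assoc a b (- b)) (trans (cong (_+_ a) (-‿inverseʳ b)) (+-identityʳ a))

  a-b+b≡a : ∀ a b → a - b + b ≡ a
  a-b+b≡a a b = trans (+-assoc a (- b) b) (trans (cong (_+_ a) (-‿inverseˡ b)) (+-identityʳ a))

  +-monoʳ-≤ : ∀ c {a b} → a ≤ b → c + a ≤ c + b
  +-monoʳ-≤ c {a} {b} a≤b = subst₂ _≤_ (+-comm a c) (+-comm b c) (+-monoˡ-≤ a b c a≤b)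

  +-mono-≤ : ∀ {a b c d} → a ≤ b → c ≤ d → a + c ≤ b + d
  +-mono-≤ {a} {b} {c} a≤b c≤d = ≤-trans (+-monoˡ-≤ a b c a≤b) (+-monoʳ-≤ b c≤d)

  +-cancelʳ-≤ : ∀ c {a b} → a + c ≤ b + c → a ≤ b
  +-cancelʳ-≤ c {a} {b} p = subst₂ _≤_ (a+b-b≡a a c) (a+b-b≡a b c) (+-monoˡ-≤ _ _ (- c) p)

  +-mono-<-≤ : ∀ {a b c d} → a < b → c ≤ d → a + c < b + d
  +-mono-<-≤ {a} {b} {c} (a≤b , a≢b) c≤d = +-mono-≤ a≤b c≤d , λ a+c≡b+d →
    a≢b (antisym a≤b (+-cancelʳ-≤ c (≤-trans (+-monoʳ-≤ b c≤d) (≤-reflexive (sym a+c≡b+d)))))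

  ≤⇒0≤- : ∀ {a b} → a ≤ b → 0# ≤ b - a
  ≤⇒0≤- {a} {b} a≤b = subst (_≤ b - a) (-‿inverseʳ a) (+-monoˡ-≤ a b (- a) a≤b)

  *-monoˡ-≤-nonNeg : ∀ c {a b} → 0# ≤ c → a ≤ b → c * a ≤ c * b
  *-monoˡ-≤-nonNeg c {a} {b} 0≤c a≤b = begin
    c * a               ≡⟨ sym (+-identityˡ (c * a)) ⟩
    0# + c * a          ≤⟨ +-monoˡ-≤ _ _ (c * a) (*-nonneg c (b - a) 0≤c (≤⇒0≤- a≤b)) ⟩
    c * (b - a) + c * a ≡⟨ sym (distribˡ c (b - a) a) ⟩
    c * (b - a + a)     ≡⟨ cong (c *_) (a-b+b≡a b a) ⟩
    c * b               ∎
    where open ≤-Reasoning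

  0≤1 : 0# ≤ 1#
  0≤1 with total 0# 1#
  ... | inj₁ 0≤1 = 0≤1
  ... | inj₂ 1≤0 = subst (0# ≤_) (trans (-1*x≈-x (- 1#)) (-‿involutive 1#)) (*-nonneg _ _ 0≤-1 0≤-1)
    where
    0≤-1 : 0# ≤ - 1#
    0≤-1 = subst (0# ≤_) (+-identityˡ (- 1#)) (≤⇒0≤- 1≤0)

  0≤+ : ∀ {a b} → 0# ≤ a → 0# ≤ b → 0# ≤ a + b
  0≤+ 0≤a 0≤b = subst (_≤ _) (+-identityˡ 0#) (+-mono-≤ 0≤a 0≤b)

  a≤a+b : ∀ a {b} → 0# ≤ b → a ≤ a + b
  a≤a+b a {b} 0≤b = subst (_≤ a + b) (+-identityʳ a) (+-monoʳ-≤ a 0≤b)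

  0≤ιℕ : ∀ n → 0# ≤ ιℕ n
  0≤ιℕ zero    = ≤-refl
  0≤ιℕ (suc n) = 0≤+ 0≤1 (0≤ιℕ n)

  ιℕ-+ : ∀ m n → ιℕ (m ℕ.+ n) ≡ ιℕ m + ιℕ n
  ιℕ-+ zero    n = sym (+-identityˡ (ιℕ n))
  ιℕ-+ (suc m) n = trans (cong (_+_ 1#) (ιℕ-+ m n)) (sym (+-assoc 1# (ιℕ m) (ιℕ n)))

  ιℕ-* : ∀ m n → ιℕ (m ℕ.* n) ≡ ιℕ m * ιℕ n
  ιℕ-* zero    n = sym (zeroˡ (ιℕ n))
  ιℕ-* (suc m) n = begin
    ιℕ (n ℕ.+ m ℕ.* n)     ≡⟨ ιℕ-+ n (m ℕ.* n) ⟩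
    ιℕ n + ιℕ (m ℕ.* n)    ≡⟨ cong₂ _+_ (sym (*-identityˡ (ιℕ n))) (ιℕ-* m n) ⟩
    1# * ιℕ n + ιℕ m * ιℕ n ≡⟨ sym (distribʳ (ιℕ n) 1# (ιℕ m)) ⟩
    (1# + ιℕ m) * ιℕ n     ∎
    where open ≡-Reasoning

  ιℕ-mono-≤ : ∀ {m n} → m ℕ.≤ n → ιℕ m ≤ ιℕ n
  ιℕ-mono-≤ {m} m≤n with ℕₚ.m≤n⇒∃[o]m+o≡n m≤n
  ... | k , refl = subst (ιℕ m ≤_) (sym (ιℕ-+ m k)) (a≤a+b (ιℕ m) (0≤ιℕ k))

  ιℕ-suc≢0 : ∀ n → ιℕ (suc n) ≢ 0#
  ιℕ-suc≢0 n 1+n≡0 = 0≢1 (antisym 0≤1 (subst (1# ≤_) 1+n≡0 (a≤a+b 1# (0≤ιℕ n))))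

  ind : Bool → K
  ind b = if b then 1# else 0#

  if≡ind* : ∀ b a → (if b then a else 0#) ≡ ind b * a
  if≡ind* true  a = sym (*-identityˡ a)
  if≡ind* false a = sym (zeroˡ a)

  0≤ind : ∀ b → 0# ≤ ind b
  0≤ind true  = 0≤1
  0≤ind false = ≤-refl

  ind-mono-∪ : ∀ f g h → (T f → T g ⊎ T h) → ind f ≤ ind g + ind h
  ind-mono-∪ false g     h     _       = 0≤+ (0≤ind g) (0≤ind h)
  ind-mono-∪ true  true  h     _       = a≤a+b 1# (0≤ind h)
  ind-mono-∪ true  false true  _       = ≤-reflexive (sym (+-identityˡ 1#))
  ind-mono-∪ true  false false f⊆g∪h = [ (λ ()) , (λ ()) ]′ (f⊆g∪h tt)

  ind-+ : ∀ a b → ind a + ind b ≡ ind (a ∧ b) + ind (a ∧ b) + ind (a xor b)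
  ind-+ true  true  = sym (+-identityʳ (1# + 1#))
  ind-+ true  false = trans (+-identityʳ 1#) (sym (trans (cong (_+ 1#) (+-identityˡ 0#)) (+-identityˡ 1#)))
  ind-+ false true  = cong (_+ 1#) (sym (+-identityˡ 0#))
  ind-+ false false = sym (+-identityʳ (0# + 0#))

  sparsity-contradiction : ∀ {ρ J A B ε m X Y} → 0# ≤ ρ → J < ρ * (2# - A - ε) → J < ρ * (2# - B - ε) →
    m + m ≤ Y + Y + (A + B) → Y ≤ X + ε → ρ * X + (ρ + ρ) ≤ ρ * m + J → ⊥
  sparsity-contradiction {ρ} {J} {A} {B} {ε} {m} {X} {Y} 0≤ρ J<ρθA J<ρθB deficit Y≤X+ε sparse =
    ≤⇒≯ ρθ≤J (+-mono-<-≤ J<ρθA (proj₁ J<ρθB))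
    where
    θA = 2# - A - ε
    θB = 2# - B - ε
    θ+ε+c≡2 : ∀ c → 2# - c - ε + ε + c ≡ 2#
    θ+ε+c≡2 c = trans (cong (_+ c) (a-b+b≡a (2# - c) ε)) (a-b+b≡a 2# c)
    open ≤-Reasoning
    ρθ≤J : ρ * θA + ρ * θB ≤ J + J
    ρθ≤J = +-cancelʳ-≤ (ρ * (m + m) + (ρ * ε + ρ * ε)) (begin
      ρ * θA + ρ * θB + (ρ * (m + m) + (ρ * ε + ρ * ε))
        ≤⟨ +-monoʳ-≤ _ (+-monoˡ-≤ _ _ _ (*-monoˡ-≤-nonNeg ρ 0≤ρ deficit)) ⟩
      ρ * θA + ρ * θB + (ρ * (Y + Y + (A + B)) + (ρ * ε + ρ * ε))
        ≡⟨ solve 8 (λ ρ θA θB Y A B ε m →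
             ρ :* θA :+ ρ :* θB :+ (ρ :* (Y :+ Y :+ (A :+ B)) :+ (ρ :* ε :+ ρ :* ε))
             := ρ :* (θA :+ ε :+ A) :+ ρ :* (θB :+ ε :+ B) :+ (ρ :* Y :+ ρ :* Y)) refl ρ θA θB Y A B ε m ⟩
      ρ * (θA + ε + A) + ρ * (θB + ε + B) + (ρ * Y + ρ * Y)
        ≡⟨ cong₂ (λ a b → ρ * a + ρ * b + (ρ * Y + ρ * Y)) (θ+ε+c≡2 A) (θ+ε+c≡2 B) ⟩
      ρ * 2# + ρ * 2# + (ρ * Y + ρ * Y)
        ≤⟨ +-monoʳ-≤ _ (+-mono-≤ ρY≤ρ[X+ε] ρY≤ρ[X+ε]) ⟩
      ρ * 2# + ρ * 2# + (ρ * (X + ε) + ρ * (X + ε))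
        ≡⟨ solve 3 (λ ρ X ε →
             ρ :* con 2 :+ ρ :* con 2 :+ (ρ :* (X :+ ε) :+ ρ :* (X :+ ε))
             := ρ :* X :+ (ρ :+ ρ) :+ (ρ :* X :+ (ρ :+ ρ)) :+ (ρ :* ε :+ ρ :* ε)) refl ρ X ε ⟩
      ρ * X + (ρ + ρ) + (ρ * X + (ρ + ρ)) + (ρ * ε + ρ * ε)
        ≤⟨ +-monoˡ-≤ _ _ _ (+-mono-≤ sparse sparse) ⟩
      ρ * m + J + (ρ * m + J) + (ρ * ε + ρ * ε)
        ≡⟨ solve 4 (λ ρ m J ε →
             ρ :* m :+ J :+ (ρ :* m :+ J) :+ (ρ :* ε :+ ρ :* ε)
             := J :+ J :+ (ρ :* (m :+ m) :+ (ρ :* ε :+ ρ :* ε))) refl ρ m J ε ⟩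
      J + J + (ρ * (m + m) + (ρ * ε + ρ * ε)) ∎)
      where
      ρY≤ρ[X+ε] = *-monoˡ-≤-nonNeg ρ 0≤ρ Y≤X+ε

module CeilFieldProperties (𝔽 : CeilField) where
  open CeilField 𝔽
  open OrderedFieldProperties ordered

  +suc≤⌈⌉⇒ιℕ< : ∀ {y} j → + suc j ℤ.≤ ⌈ y ⌉ → ιℕ j < y
  +suc≤⌈⌉⇒ιℕ< {y} j = go (ceil-lower y)
    where
    open ≤-Reasoning
    go : ∀ {z} → ιℤ z - 1# < y → + suc j ℤ.≤ z → ιℕ j < y
    go {+ k} ⌈y⌉-1<y (ℤ.+≤+ 1+j≤k) = begin-strict
      ιℕ j              ≡⟨ sym (a+b-b≡a (ιℕ j) 1#) ⟩
      ιℕ j + 1# - 1#    ≡⟨ cong (_- 1#) (+-comm (ιℕ j) 1#) ⟩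
      ιℕ (suc j) - 1#   ≤⟨ +-monoˡ-≤ _ _ (- 1#) (ιℕ-mono-≤ 1+j≤k) ⟩
      ιℕ k - 1#         <⟨ ⌈y⌉-1<y ⟩
      y                 ∎

module Sums (𝔽 : OrderedField) where
  open OrderedField 𝔽
  open OrderedFieldProperties 𝔽
  open import Algebra.Properties.CommutativeSemigroup
    (CommutativeSemiring.+-commutativeSemigroup commutativeSemiring) using (interchange)

  module _ {A : Set} where
    ∑ : List A → (A → K) → K
    ∑ xs f = sumK (map f xs)

    ∑-congᴬ : ∀ {xs} {f g : A → K} → All (λ x → f x ≡ g x) xs → ∑ xs f ≡ ∑ xs g
    ∑-congᴬ []       = refl
    ∑-congᴬ (e ∷ es) = cong₂ _+_ e (∑-congᴬ es)

    ∑-cong : ∀ xs {f g : A → K} → (∀ x → f x ≡ g x) → ∑ xs f ≡ ∑ xs g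
    ∑-cong xs f≗g = ∑-congᴬ (All.universal f≗g xs)

    ∑-mono-≤ : ∀ {xs} {f g : A → K} → All (λ x → f x ≤ g x) xs → ∑ xs f ≤ ∑ xs g
    ∑-mono-≤ []       = ≤-refl
    ∑-mono-≤ (p ∷ ps) = +-mono-≤ p (∑-mono-≤ ps)

    ∑-zero : ∀ xs → ∑ xs (λ _ → 0#) ≡ 0#
    ∑-zero []       = refl
    ∑-zero (x ∷ xs) = trans (+-identityˡ _) (∑-zero xs)

    ∑-distrib-+ : ∀ xs (f g : A → K) → ∑ xs (λ x → f x + g x) ≡ ∑ xs f + ∑ xs g
    ∑-distrib-+ []       f g = sym (+-identityˡ 0#)
    ∑-distrib-+ (x ∷ xs) f g =
      trans (cong (_+_ (f x + g x)) (∑-distrib-+ xs f g)) (interchange (f x) (g x) (∑ xs f) (∑ xs g))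

    *-distribˡ-∑ : ∀ c xs (f : A → K) → c * ∑ xs f ≡ ∑ xs (λ x → c * f x)
    *-distribˡ-∑ c []       f = zeroʳ c
    *-distribˡ-∑ c (x ∷ xs) f = trans (distribˡ c (f x) (∑ xs f)) (cong (_+_ (c * f x)) (*-distribˡ-∑ c xs f))

    *-distribʳ-∑ : ∀ c xs (f : A → K) → ∑ xs f * c ≡ ∑ xs (λ x → f x * c)
    *-distribʳ-∑ c []       f = zeroˡ c
    *-distribʳ-∑ c (x ∷ xs) f = trans (distribʳ c (f x) (∑ xs f)) (cong (_+_ (f x * c)) (*-distribʳ-∑ c xs f))

    ∑-ind : ∀ xs (p : A → Bool) → ∑ xs (ind ∘ p) ≡ ιℕ (length (filterᵇ p xs))
    ∑-ind []       p = refl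
    ∑-ind (x ∷ xs) p with p x
    ... | true  = cong (_+_ 1#) (∑-ind xs p)
    ... | false = trans (+-identityˡ _) (∑-ind xs p)

  ∑-comm : ∀ {A B : Set} (xs : List A) (ys : List B) (f : A → B → K) →
           ∑ xs (λ a → ∑ ys (f a)) ≡ ∑ ys (λ b → ∑ xs (λ a → f a b))
  ∑-comm []       ys f = sym (∑-zero ys)
  ∑-comm (x ∷ xs) ys f =
    trans (cong (_+_ (∑ ys (f x))) (∑-comm xs ys f)) (sym (∑-distrib-+ ys (f x) (λ b → ∑ xs (λ a → f a b))))

  ∑-allFin-suc : ∀ {n} (f : Fin (suc n) → K) → ∑ (allFin (suc n)) f ≡ f Fin.zero + ∑ (allFin n) (f ∘ Fin.suc)
  ∑-allFin-suc f = cong (λ xs → f Fin.zero + sumK xs)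
    (trans (map-tabulate Fin.suc f) (sym (map-tabulate (λ i → i) (f ∘ Fin.suc))))

  ιℕ-sum : ∀ {m} (e : Fin m → ℕ) → ιℕ (sum e) ≡ ∑ (allFin m) (ιℕ ∘ e)
  ιℕ-sum {zero}  e = refl
  ιℕ-sum {suc m} e = trans (ιℕ-+ (e Fin.zero) (sum (e ∘ Fin.suc)))
    (trans (cong (_+_ (ιℕ (e Fin.zero))) (ιℕ-sum (e ∘ Fin.suc))) (sym (∑-allFin-suc (ιℕ ∘ e))))

  ∑-allFin-δ : ∀ {n} (g : Fin n → K) a → ∑ (allFin n) (λ v → g v * ind ⌊ a Fin.≟ v ⌋) ≡ g a
  ∑-allFin-δ {suc n} g Fin.zero = begin
    ∑ (allFin (suc n)) (λ v → g v * ind ⌊ Fin.zero Fin.≟ v ⌋)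
      ≡⟨ ∑-allFin-suc (λ v → g v * ind ⌊ Fin.zero Fin.≟ v ⌋) ⟩
    g Fin.zero * 1# + ∑ (allFin n) (λ v → g (Fin.suc v) * 0#)
      ≡⟨ cong₂ _+_ (*-identityʳ _) (trans (∑-cong (allFin n) (λ v → zeroʳ _)) (∑-zero (allFin n))) ⟩
    g Fin.zero + 0#
      ≡⟨ +-identityʳ _ ⟩
    g Fin.zero ∎
    where open ≡-Reasoning
  ∑-allFin-δ {suc n} g (Fin.suc a) = begin
    ∑ (allFin (suc n)) (λ v → g v * ind ⌊ Fin.suc a Fin.≟ v ⌋)
      ≡⟨ ∑-allFin-suc (λ v → g v * ind ⌊ Fin.suc a Fin.≟ v ⌋) ⟩
    g Fin.zero * 0# + ∑ (allFin n) (λ v → g (Fin.suc v) * ind ⌊ Fin.suc a Fin.≟ Fin.suc v ⌋)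
      ≡⟨ cong₂ _+_ (zeroʳ (g Fin.zero)) (∑-cong (allFin n) (λ v → cong (λ b → g (Fin.suc v) * ind b) (suc≟suc v))) ⟩
    0# + ∑ (allFin n) (λ v → g (Fin.suc v) * ind ⌊ a Fin.≟ v ⌋)
      ≡⟨ trans (+-identityˡ _) (∑-allFin-δ (g ∘ Fin.suc) a) ⟩
    g (Fin.suc a) ∎
    where
    open ≡-Reasoning
    suc≟suc : ∀ v → ⌊ Fin.suc a Fin.≟ Fin.suc v ⌋ ≡ ⌊ a Fin.≟ v ⌋
    suc≟suc v with a Fin.≟ v
    ... | yes _ = refl
    ... | no  _ = refl

edges-ordered : ∀ n → All (λ e → toℕ (proj₁ e) ℕ.< toℕ (proj₂ e)) (edges n)
edges-ordered n = All.map (λ {e} → ℕₚ.<ᵇ⇒< (toℕ (proj₁ e)) (toℕ (proj₂ e)))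
  (Allₚ.all-filter (λ e → T? (toℕ (proj₁ e) ℕ.<ᵇ toℕ (proj₂ e))) (concatMap (λ u → map (u ,_) (allFin n)) (allFin n)))

edges-unique : ∀ n → Unique (edges n)
edges-unique n = Uniqueₚ.filter⁺ _ (subst Unique (sym (pairs≡cartesianProduct (allFin n)))
  (Uniqueₚ.cartesianProduct⁺ (Uniqueₚ.allFin⁺ n) (Uniqueₚ.allFin⁺ n)))
  where
  pairs≡cartesianProduct : ∀ xs → concatMap (λ u → map (u ,_) (allFin n)) xs ≡ cartesianProduct xs (allFin n)
  pairs≡cartesianProduct []       = refl
  pairs≡cartesianProduct (x ∷ xs) = cong (map (x ,_) (allFin n) ++_) (pairs≡cartesianProduct xs)

size : ∀ {n} → VSet n → ℕ
size {n} M = length (filterᵇ M (allFin n))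

module Weights (𝔽 : OrderedField) {n : ℕ} where
  open OrderedField 𝔽
  open OrderedFieldProperties 𝔽
  open Sums 𝔽

  wt≡∑ : ∀ (x : Vec-E 𝔽 n) F → wt 𝔽 x F ≡ ∑ (edges n) (λ e → ind (uncurry F e) * uncurry x e)
  wt≡∑ x F = ∑-cong (edges n) (λ e → if≡ind* (uncurry F e) (uncurry x e))

  wt-cong : ∀ x {F G : EdgeSet n} → (∀ u v → F u v ≡ G u v) → wt 𝔽 x F ≡ wt 𝔽 x G
  wt-cong x F≗G = ∑-cong (edges n) (λ e → cong (λ b → if b then uncurry x e else 0#) (uncurry F≗G e))

  wt-mono-∪ : ∀ {x : Vec-E 𝔽 n} {F G H : EdgeSet n} → (∀ u v → toℕ u ℕ.< toℕ v → 0# ≤ x u v) →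
              (∀ u v → T (F u v) → T (G u v) ⊎ T (H u v)) → wt 𝔽 x F ≤ wt 𝔽 x G + wt 𝔽 x H
  wt-mono-∪ {x} {F} {G} {H} x≥0 F⊆G∪H = begin
    wt 𝔽 x F
      ≡⟨ wt≡∑ x F ⟩
    ∑ (edges n) (term F)
      ≤⟨ ∑-mono-≤ (All.map (λ {e} u<v → edgewise e (uncurry x≥0 e u<v)) (edges-ordered n)) ⟩
    ∑ (edges n) (λ e → term G e + term H e)
      ≡⟨ ∑-distrib-+ (edges n) (term G) (term H) ⟩
    ∑ (edges n) (term G) + ∑ (edges n) (term H)
      ≡⟨ sym (cong₂ _+_ (wt≡∑ x G) (wt≡∑ x H)) ⟩
    wt 𝔽 x G + wt 𝔽 x H ∎
    where
    open ≤-Reasoning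
    term : EdgeSet n → Fin n × Fin n → K
    term F e = ind (uncurry F e) * uncurry x e
    edgewise : ∀ e → 0# ≤ uncurry x e → term F e ≤ term G e + term H e
    edgewise e 0≤xe = subst₂ _≤_ (*-comm (uncurry x e) _) (trans (*-comm (uncurry x e) _) (distribʳ _ _ _))
      (*-monoˡ-≤-nonNeg (uncurry x e) 0≤xe (ind-mono-∪ _ _ _ (uncurry F⊆G∪H e)))

  wt-χ : ∀ (F S : EdgeSet n) →
         wt 𝔽 (χ 𝔽 S) F ≡ ιℕ (length (filterᵇ (λ e → uncurry F e ∧ uncurry S e) (edges n)))
  wt-χ F S = trans (∑-cong (edges n) (λ e → if-if (uncurry F e) (uncurry S e))) (∑-ind (edges n) _)
    where
    if-if : ∀ a b → (if a then (if b then 1# else 0#) else 0#) ≡ ind (a ∧ b)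
    if-if true  b = refl
    if-if false b = refl

  *-wt-avg : ∀ {r} (S : Fin r → EdgeSet n) F → ιℕ r ≢ 0# →
             ιℕ r * wt 𝔽 (avg 𝔽 S) F ≡ ∑ (allFin r) (λ k → wt 𝔽 (χ 𝔽 (S k)) F)
  *-wt-avg {r} S F ρ≢0 = begin
    ρ * wt 𝔽 (avg 𝔽 S) F
      ≡⟨ cong (ρ *_) (∑-cong E (λ e → pull (uncurry F e) (λ k → uncurry (χ 𝔽 (S k)) e))) ⟩
    ρ * ∑ E (λ e → ρ ⁻¹ * ∑ ks (h e))
      ≡⟨ cong (ρ *_) (sym (*-distribˡ-∑ (ρ ⁻¹) E _)) ⟩
    ρ * (ρ ⁻¹ * ∑ E (λ e → ∑ ks (h e)))
      ≡⟨ sym (*-assoc ρ (ρ ⁻¹) _) ⟩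
    ρ * ρ ⁻¹ * ∑ E (λ e → ∑ ks (h e))
      ≡⟨ trans (cong (_* ∑ E (λ e → ∑ ks (h e))) (inverse ρ ρ≢0)) (*-identityˡ _) ⟩
    ∑ E (λ e → ∑ ks (h e))
      ≡⟨ ∑-comm E ks h ⟩
    ∑ ks (λ k → wt 𝔽 (χ 𝔽 (S k)) F) ∎
    where
    open ≡-Reasoning
    ρ = ιℕ r
    E = edges n
    ks = allFin r
    h : Fin n × Fin n → Fin r → K
    h e k = if uncurry F e then uncurry (χ 𝔽 (S k)) e else 0#
    pull : ∀ b (g : Fin r → K) →
           (if b then ρ ⁻¹ * ∑ ks g else 0#) ≡ ρ ⁻¹ * ∑ ks (λ k → if b then g k else 0#)
    pull true  g = refl
    pull false g = sym (trans (cong (ρ ⁻¹ *_) (∑-zero ks)) (zeroʳ (ρ ⁻¹)))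

  endpoint-count : ∀ (M : VSet n) {u w} → u ≢ w →
    ∑ (allFin n) (λ v → ind (M v) * ind (δ (single v) u w)) ≡ ind (M u) + ind (M w)
  endpoint-count M {u} {w} u≢w = begin
    ∑ V (λ v → ind (M v) * ind (δ (single v) u w))
      ≡⟨ ∑-cong V (λ v → trans (cong (ind (M v) *_) (ind-xor v)) (distribˡ (ind (M v)) _ _)) ⟩
    ∑ V (λ v → ind (M v) * ind ⌊ u Fin.≟ v ⌋ + ind (M v) * ind ⌊ w Fin.≟ v ⌋)
      ≡⟨ ∑-distrib-+ V _ _ ⟩
    ∑ V (λ v → ind (M v) * ind ⌊ u Fin.≟ v ⌋) + ∑ V (λ v → ind (M v) * ind ⌊ w Fin.≟ v ⌋)
      ≡⟨ cong₂ _+_ (∑-allFin-δ (ind ∘ M) u) (∑-allFin-δ (ind ∘ M) w) ⟩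
    ind (M u) + ind (M w) ∎
    where
    open ≡-Reasoning
    V = allFin n
    ind-xor : ∀ v → ind (⌊ u Fin.≟ v ⌋ xor ⌊ w Fin.≟ v ⌋) ≡ ind ⌊ u Fin.≟ v ⌋ + ind ⌊ w Fin.≟ v ⌋
    ind-xor v with u Fin.≟ v | w Fin.≟ v
    ... | yes refl | yes refl = ⊥-elim (u≢w refl)
    ... | yes _    | no _     = sym (+-identityʳ 1#)
    ... | no _     | yes _    = sym (+-identityˡ 1#)
    ... | no _     | no _     = sym (+-identityˡ 0#)

  handshake : ∀ (x : Vec-E 𝔽 n) (M : VSet n) →
    ∑ (allFin n) (λ v → ind (M v) * wt 𝔽 x (δ (single v)))
      ≡ wt 𝔽 x (Einside M) + wt 𝔽 x (Einside M) + wt 𝔽 x (δ M)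
  handshake x M = begin
    ∑ V (λ v → ind (M v) * wt 𝔽 x (δ (single v)))
      ≡⟨ ∑-cong V (λ v → trans (cong (ind (M v) *_) (wt≡∑ x (δ (single v)))) (*-distribˡ-∑ (ind (M v)) E _)) ⟩
    ∑ V (λ v → ∑ E (λ e → ind (M v) * (ind (uncurry (δ (single v)) e) * uncurry x e)))
      ≡⟨ ∑-comm V E _ ⟩
    ∑ E (λ e → ∑ V (λ v → ind (M v) * (ind (uncurry (δ (single v)) e) * uncurry x e)))
      ≡⟨ ∑-congᴬ (All.map (λ {e} → per-edge e) (edges-ordered n)) ⟩
    ∑ E (λ e → term (Einside M) e + term (Einside M) e + term (δ M) e)
      ≡⟨ trans (∑-distrib-+ E _ _) (cong (_+ ∑ E (term (δ M))) (∑-distrib-+ E _ _)) ⟩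
    ∑ E (term (Einside M)) + ∑ E (term (Einside M)) + ∑ E (term (δ M))
      ≡⟨ sym (cong₂ _+_ (cong₂ _+_ (wt≡∑ x (Einside M)) (wt≡∑ x (Einside M))) (wt≡∑ x (δ M))) ⟩
    wt 𝔽 x (Einside M) + wt 𝔽 x (Einside M) + wt 𝔽 x (δ M) ∎
    where
    open ≡-Reasoning
    V = allFin n
    E = edges n
    term : EdgeSet n → Fin n × Fin n → K
    term F e = ind (uncurry F e) * uncurry x e
    per-edge : ∀ e → toℕ (proj₁ e) ℕ.< toℕ (proj₂ e) →
      ∑ V (λ v → ind (M v) * (ind (uncurry (δ (single v)) e) * uncurry x e))
        ≡ term (Einside M) e + term (Einside M) e + term (δ M) e
    per-edge (u , w) u<w = begin
      ∑ V (λ v → ind (M v) * (ind (δ (single v) u w) * x u w))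
        ≡⟨ ∑-cong V (λ v → sym (*-assoc (ind (M v)) _ (x u w))) ⟩
      ∑ V (λ v → ind (M v) * ind (δ (single v) u w) * x u w)
        ≡⟨ sym (*-distribʳ-∑ (x u w) V _) ⟩
      ∑ V (λ v → ind (M v) * ind (δ (single v) u w)) * x u w
        ≡⟨ cong (_* x u w) (trans (endpoint-count M (λ { refl → ℕₚ.<-irrefl refl u<w })) (ind-+ (M u) (M w))) ⟩
      (ind (M u ∧ M w) + ind (M u ∧ M w) + ind (M u xor M w)) * x u w
        ≡⟨ trans (distribʳ (x u w) _ _) (cong (_+ term (δ M) (u , w)) (distribʳ (x u w) _ _)) ⟩
      term (Einside M) (u , w) + term (Einside M) (u , w) + term (δ M) (u , w) ∎

  DeficitAtMost : Vec-E 𝔽 n → VSet n → K → Set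
  DeficitAtMost x M b = ιℕ (size M) + ιℕ (size M) ≤ wt 𝔽 x (Einside M) + wt 𝔽 x (Einside M) + b

  inside-degrees : ∀ {x : Vec-E 𝔽 n} {s t} M →
    (∀ v → v ≢ s → v ≢ t → wt 𝔽 x (δ (single v)) ≡ 2#) → wt 𝔽 x (δ (single s)) ≡ 1# → ¬ T (M t) →
    wt 𝔽 x (Einside M) + wt 𝔽 x (Einside M) + wt 𝔽 x (δ M) + ind (M s) ≡ ιℕ (size M) + ιℕ (size M)
  inside-degrees {x} {s} {t} M deg deg-s t∉M = begin
    wt 𝔽 x (Einside M) + wt 𝔽 x (Einside M) + wt 𝔽 x (δ M) + ind (M s)
      ≡⟨ cong₂ _+_ (sym (handshake x M)) (sym (∑-allFin-δ (ind ∘ M) s)) ⟩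
    ∑ V (λ v → ind (M v) * d v) + ∑ V (λ v → ind (M v) * ind ⌊ s Fin.≟ v ⌋)
      ≡⟨ sym (∑-distrib-+ V _ _) ⟩
    ∑ V (λ v → ind (M v) * d v + ind (M v) * ind ⌊ s Fin.≟ v ⌋)
      ≡⟨ ∑-cong V pointwise ⟩
    ∑ V (λ v → ind (M v) + ind (M v))
      ≡⟨ ∑-distrib-+ V (ind ∘ M) (ind ∘ M) ⟩
    ∑ V (ind ∘ M) + ∑ V (ind ∘ M)
      ≡⟨ cong₂ _+_ (∑-ind V M) (∑-ind V M) ⟩
    ιℕ (size M) + ιℕ (size M)
      ∎
    where
    open ≡-Reasoning
    V = allFin n
    d : Fin n → K
    d v = wt 𝔽 x (δ (single v))
    degree+δ : ∀ v → v ≢ t → d v + ind ⌊ s Fin.≟ v ⌋ ≡ 1# + 1#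
    degree+δ v v≢t with s Fin.≟ v
    ... | yes refl = cong (_+ 1#) deg-s
    ... | no  s≢v  = trans (cong (_+ 0#) (deg v (s≢v ∘ sym) v≢t)) (+-identityʳ _)
    pointwise : ∀ v → ind (M v) * d v + ind (M v) * ind ⌊ s Fin.≟ v ⌋ ≡ ind (M v) + ind (M v)
    pointwise v with M v in Mv≡true
    ... | false = cong₂ _+_ (zeroˡ _) (zeroˡ _)
    ... | true  = trans (cong₂ _+_ (*-identityˡ _) (*-identityˡ _))
                        (degree+δ v (λ v≡t → t∉M (subst (T ∘ M) v≡t (subst T (sym Mv≡true) tt))))

∈-─ : ∀ {A : Set} {x y : A} {xs} (x∈xs : x ∈ xs) → y ∈ xs → y ≢ x → y ∈ xs ─ x∈xs
∈-─ (here refl)  (here refl)  y≢x = ⊥-elim (y≢x refl)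
∈-─ (here _)     (there y∈xs) _   = y∈xs
∈-─ (there _)    (here y≡z)   _   = here y≡z
∈-─ (there x∈xs) (there y∈xs) y≢x = there (∈-─ x∈xs y∈xs y≢x)

module Forest {n : ℕ} (F : EdgeSet n) (M : VSet n) where
  open import Data.List.Membership.DecPropositional {A = Fin n} Fin._≟_ using (_∈?_)

  InsideEdge : Fin n × Fin n → Set
  InsideEdge (u , v) = toℕ u ℕ.< toℕ v × T (F u v) × T (M u) × T (M v)

  insideEdges : List (Fin n × Fin n)
  insideEdges = filterᵇ (λ e → uncurry (Einside M) e ∧ uncurry F e) (edges n)

  insideEdges-unique : Unique insideEdges
  insideEdges-unique = Uniqueₚ.filter⁺ _ (edges-unique n)

  insideEdges-inside : All InsideEdge insideEdges
  insideEdges-inside = All.zipWith (λ { {u , v} (u<v , p) → inside u<v p })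
    (Allₚ.filter⁺ _ (edges-ordered n) , Allₚ.all-filter _ (edges n))
    where
    inside : ∀ {u v} → toℕ u ℕ.< toℕ v → T (Einside M u v ∧ F u v) → InsideEdge (u , v)
    inside u<v p with Equivalence.to T-∧ p
    ... | Muv , Fuv with Equivalence.to T-∧ Muv
    ... | Mu , Mv = u<v , Fuv , Mu , Mv

  Step : List (Fin n × Fin n) → Fin n → Fin n → Set
  Step L = SymClosure (λ u v → (u , v) ∈ L)

  Linked : List (Fin n × Fin n) → Fin n → Fin n → Set
  Linked L = EqClosure (λ u v → (u , v) ∈ L)

  step⇒Adj : ∀ {L u w} → All InsideEdge L → Step L u w → Adj F u w × T (M u) × T (M w)
  step⇒Adj inside (fwd uw∈L) with All.lookup inside uw∈L
  ... | u<w , Fuw , Mu , Mw = inj₁ (u<w , Fuw) , Mu , Mw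
  step⇒Adj inside (bwd wu∈L) with All.lookup inside wu∈L
  ... | w<u , Fwu , Mw , Mu = inj₂ (w<u , Fwu) , Mu , Mw

  linked⇒Walk : ∀ {L u v} → All InsideEdge L → T (M u) → Linked L u v → Walk F M u v
  linked⇒Walk inside Mu Star.ε        = here Mu
  linked⇒Walk inside Mu (s ◅ us) with step⇒Adj inside s
  ... | uw , _ , Mw = step Mu uw (linked⇒Walk inside Mw us)

  data Path (L : List (Fin n × Fin n)) : Fin n → List (Fin n) → Fin n → Set where
    []  : ∀ {u} → Path L u [] u
    _∷_ : ∀ {u w ws v} → Step L u w → Path L w ws v → Path L u (w ∷ ws) v

  SimplePath : List (Fin n × Fin n) → Fin n → Fin n → Set
  SimplePath L u v = Σ (List (Fin n)) λ ws → Path L u ws v × Unique (u ∷ ws)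

  suffix : ∀ {L w ws v u} → Path L w ws v → Unique (w ∷ ws) → u ∈ w ∷ ws → SimplePath L u v
  suffix {ws = ws} p       uniq       (here refl)  = ws , p , uniq
  suffix           (_ ∷ p) (_ ∷ uniq) (there u∈ws) = suffix p uniq u∈ws

  prepend : ∀ {L u w v} → Step L u w → SimplePath L w v → SimplePath L u v
  prepend {u = u} {w} s (ws , p , uniq) with u ∈? w ∷ ws
  ... | yes u∈ = suffix p uniq u∈
  ... | no  u∉ = w ∷ ws , s ∷ p , Allₚ.¬Any⇒All¬ _ u∉ ∷ uniq

  linked⇒SimplePath : ∀ {L u v} → Linked L u v → SimplePath L u v
  linked⇒SimplePath Star.ε        = [] , [] , [] ∷ []
  linked⇒SimplePath (s ◅ us) = prepend s (linked⇒SimplePath us)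

  path⇒ConsecAdj : ∀ {L u ws v z} → All InsideEdge L → Path L u ws v → Adj F v z →
                   ConsecAdj F u (ws ++ [ z ])
  path⇒ConsecAdj inside []      vz = vz , tt
  path⇒ConsecAdj inside (s ∷ p) vz = proj₁ (step⇒Adj inside s) , path⇒ConsecAdj inside p vz

  acyclic⇒¬linked : ¬ HasCycle F → ∀ {L a b} → All InsideEdge L →
                    InsideEdge (a , b) → (a , b) ∉ L → ¬ Linked L a b
  acyclic⇒¬linked acyclic {a = a} inside (a<b , Fab , _) ab∉L a~b with linked⇒SimplePath a~b
  ... | [] , [] , _                   = ℕₚ.<-irrefl refl a<b
  ... | _ ∷ [] , fwd ab∈L ∷ [] , _    = ab∉L ab∈L
  ... | _ ∷ [] , bwd ba∈L ∷ [] , _    = ℕₚ.<-asym a<b (proj₁ (All.lookup inside ba∈L))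
  ... | w₁ ∷ w₂ ∷ ws , p , uniq =
    acyclic (a , w₁ ∷ w₂ ∷ ws , ℕ.s≤s (ℕ.s≤s ℕ.z≤n) , uniq , path⇒ConsecAdj inside p (inj₂ (a<b , Fab)))

  Represented : List (Fin n × Fin n) → List (Fin n) → Set
  Represented L R = ∀ v → T (M v) → Σ (Fin n) λ r → r ∈ R × Linked L v r

  -- R holds one vertex per component of (M, L): an edge of the acyclic F always joins two
  -- different components, so each edge of L removes one representative.
  representatives : ¬ HasCycle F → ∀ L → Unique L → All InsideEdge L →
    Σ (List (Fin n)) λ R → Represented L R × length L ℕ.+ length R ℕ.≤ size M
  representatives acyclic [] _ _ =
    filterᵇ M (allFin n) , (λ v Mv → v , ∈-filter⁺ (T? ∘ M) (∈-allFin v) Mv , Star.ε) , ℕₚ.≤-refl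
  representatives acyclic ((a , b) ∷ L) (ab∉L ∷ uniq) (ab-inside ∷ inside)
    with representatives acyclic L uniq inside | ab-inside
  ... | R , represented , bound | _ , _ , Ma , Mb
    with represented a Ma | represented b Mb
  ... | ra , ra∈R , a~ra | rb , rb∈R , b~rb with ra Fin.≟ rb
  ... | yes refl = ⊥-elim (acyclic⇒¬linked acyclic inside ab-inside (Allₚ.All¬⇒¬Any ab∉L)
                                          (a~ra ◅◅ Eq.symmetric _ b~rb))
  ... | no ra≢rb = R ─ rb∈R , represented′ , bound′
    where
    weaken : ∀ {u v} → Linked L u v → Linked ((a , b) ∷ L) u v
    weaken = Eq.map there
    represented′ : Represented ((a , b) ∷ L) (R ─ rb∈R)
    represented′ v Mv with represented v Mv
    ... | r , r∈R , v~r with r Fin.≟ rb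
    ... | no  r≢rb = r , ∈-─ rb∈R r∈R r≢rb , weaken v~r
    ... | yes refl = ra , ∈-─ rb∈R ra∈R ra≢rb ,
                     weaken v~r ◅◅ Eq.symmetric _ (weaken b~rb) ◅◅ bwd (here refl) ◅ weaken a~ra
    bound′ : suc (length L) ℕ.+ length (R ─ rb∈R) ℕ.≤ size M
    bound′ = subst (ℕ._≤ size M)
      (trans (cong (length L ℕ.+_) (length-removeAt′ R (index rb∈R))) (ℕₚ.+-suc (length L) _)) bound

  edge-count : ¬ HasCycle F → ∀ {v₀} → T (M v₀) →
    length insideEdges ℕ.< size M × (Connected F M ⊎ suc (length insideEdges) ℕ.< size M)
  edge-count acyclic {v₀} Mv₀
    with representatives acyclic insideEdges insideEdges-unique insideEdges-inside
  ... | [] , represented , _ with represented v₀ Mv₀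
  ...   | _ , () , _
  edge-count acyclic Mv₀ | r ∷ [] , represented , bound =
    ℕₚ.≤-trans (ℕₚ.m<m+n (length insideEdges) ℕ.z<s) bound , inj₁ connected
    where
    connected : Connected F M
    connected u v Mu Mv with represented u Mu | represented v Mv
    ... | _ , here refl , u~r | _ , here refl , v~r =
      linked⇒Walk insideEdges-inside Mu (u~r ◅◅ Eq.symmetric _ v~r)
  edge-count acyclic Mv₀ | r₁ ∷ r₂ ∷ R , _ , bound = ℕₚ.<⇒≤ two-short , inj₂ two-short
    where
    l = length insideEdges
    two-short : suc l ℕ.< size M
    two-short = ℕₚ.≤-trans (subst (ℕ._≤ l ℕ.+ suc (suc (length R))) (ℕₚ.+-comm l 2)
                                  (ℕₚ.+-monoʳ-≤ l (ℕ.s≤s (ℕ.s≤s ℕ.z≤n)))) bound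

find-or-count : ∀ {r} (m j : ℕ) (e : Fin r → ℕ) (P : Fin r → Set) →
  (∀ k → e k ℕ.< m × (P k ⊎ suc (e k) ℕ.< m)) →
  (Σ (Fin r) λ k → j ℕ.≤ toℕ k × P k) ⊎ sum e ℕ.+ (r ℕ.+ r) ℕ.≤ r ℕ.* m ℕ.+ j
find-or-count {zero}  m j e P bounds = inj₂ ℕ.z≤n
find-or-count {suc r} m zero e P bounds
  with bounds Fin.zero | find-or-count m zero (e ∘ Fin.suc) (P ∘ Fin.suc) (bounds ∘ Fin.suc)
... | _ , inj₁ p       | _                = inj₁ (Fin.zero , ℕ.z≤n , p)
... | _ , inj₂ _       | inj₁ (k , _ , p) = inj₁ (Fin.suc k , ℕ.z≤n , p)
... | _ , inj₂ e₀+1<m  | inj₂ count      =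
  inj₂ (subst₂ ℕ._≤_ (reorder (e Fin.zero) (sum (e ∘ Fin.suc)) r) (distrib m r) (ℕₚ.+-mono-≤ e₀+1<m count))
  where
  reorder : ∀ e₀ s r → suc (suc e₀) ℕ.+ (s ℕ.+ (r ℕ.+ r)) ≡ e₀ ℕ.+ s ℕ.+ (suc r ℕ.+ suc r)
  reorder = solve-∀
  distrib : ∀ m r → m ℕ.+ (r ℕ.* m ℕ.+ 0) ≡ suc r ℕ.* m ℕ.+ 0
  distrib = solve-∀
find-or-count {suc r} m (suc j) e P bounds
  with find-or-count m j (e ∘ Fin.suc) (P ∘ Fin.suc) (bounds ∘ Fin.suc)
... | inj₁ (k , j≤k , p) = inj₁ (Fin.suc k , ℕ.s≤s j≤k , p)
... | inj₂ count =
  inj₂ (subst₂ ℕ._≤_ (reorder (e Fin.zero) (sum (e ∘ Fin.suc)) r) (distrib m r j)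
                     (ℕ.s≤s (ℕₚ.+-mono-≤ (proj₁ (bounds Fin.zero)) count)))
  where
  reorder : ∀ e₀ s r → suc (suc e₀ ℕ.+ (s ℕ.+ (r ℕ.+ r))) ≡ e₀ ℕ.+ s ℕ.+ (suc r ℕ.+ suc r)
  reorder = solve-∀
  distrib : ∀ m r j → suc (m ℕ.+ (r ℕ.* m ℕ.+ j)) ≡ suc r ℕ.* m ℕ.+ suc j
  distrib = solve-∀

module Averages (𝔽 : OrderedField) {n r : ℕ} (S : Fin r → EdgeSet n) (M : VSet n) where
  open OrderedField 𝔽
  open OrderedFieldProperties 𝔽
  open Sums 𝔽
  open Weights 𝔽

  insideCount : Fin r → ℕ
  insideCount k = length (Forest.insideEdges (S k) M)

  connected-or-sparse : (∀ k → ¬ HasCycle (S k)) → ∀ {v₀} → T (M v₀) → (j : Fin r) →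
    (Σ (Fin r) λ k → toℕ j ℕ.≤ toℕ k × Connected (S k) M) ⊎
    ιℕ r * wt 𝔽 (avg 𝔽 S) (Einside M) + (ιℕ r + ιℕ r) ≤ ιℕ r * ιℕ (size M) + ιℕ (toℕ j)
  connected-or-sparse acyclic Mv₀ j
    with find-or-count (size M) (toℕ j) insideCount (λ k → Connected (S k) M)
                       (λ k → Forest.edge-count (S k) M (acyclic k) Mv₀)
  ... | inj₁ found = inj₁ found
  ... | inj₂ count = inj₂ (subst₂ _≤_ lhs rhs (ιℕ-mono-≤ count))
    where
    open ≡-Reasoning
    ρ = ιℕ r
    ρ≢0 : ∀ {r} → Fin r → ιℕ r ≢ 0#
    ρ≢0 {suc r} _ = ιℕ-suc≢0 r
    lhs : ιℕ (sum insideCount ℕ.+ (r ℕ.+ r)) ≡ ρ * wt 𝔽 (avg 𝔽 S) (Einside M) + (ρ + ρ)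
    lhs = begin
      ιℕ (sum insideCount ℕ.+ (r ℕ.+ r))
        ≡⟨ trans (ιℕ-+ (sum insideCount) (r ℕ.+ r)) (cong₂ _+_ (ιℕ-sum insideCount) (ιℕ-+ r r)) ⟩
      ∑ (allFin r) (ιℕ ∘ insideCount) + (ρ + ρ)
        ≡⟨ cong (_+ (ρ + ρ)) (∑-cong (allFin r) (λ k → sym (wt-χ (Einside M) (S k)))) ⟩
      ∑ (allFin r) (λ k → wt 𝔽 (χ 𝔽 (S k)) (Einside M)) + (ρ + ρ)
        ≡⟨ cong (_+ (ρ + ρ)) (sym (*-wt-avg S (Einside M) (ρ≢0 j))) ⟩
      ρ * wt 𝔽 (avg 𝔽 S) (Einside M) + (ρ + ρ) ∎
    rhs : ιℕ (r ℕ.* size M ℕ.+ toℕ j) ≡ ιℕ r * ιℕ (size M) + ιℕ (toℕ j)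
    rhs = trans (ιℕ-+ (r ℕ.* size M) (toℕ j)) (cong (_+ ιℕ (toℕ j)) (ιℕ-* r (size M)))

¬T⇒≡false : ∀ {b} → ¬ T b → b ≡ false
¬T⇒≡false {false} _   = refl
¬T⇒≡false {true}  ¬tt = ⊥-elim (¬tt tt)

-- An edge uw crossing U_i ∖ U_h crosses U_h or U_i; the arguments are the memberships of u and w.
δ-diff⊆δ∪δ : ∀ hu iu hw iw → T ((iu ∧ not hu) xor (iw ∧ not hw)) → T (hu xor hw) ⊎ T (iu xor iw)
δ-diff⊆δ∪δ true  iu true  iw p = ⊥-elim (subst T (cong₂ _xor_ (∧-zeroʳ iu) (∧-zeroʳ iw)) p)
δ-diff⊆δ∪δ true  _  false _  _ = inj₁ tt
δ-diff⊆δ∪δ false _  true  _  _ = inj₁ tt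
δ-diff⊆δ∪δ false iu false iw p = inj₂ (subst T (cong₂ _xor_ (∧-identityʳ iu) (∧-identityʳ iw)) p)

module Chain {n ℓ : ℕ} (U : Fin (suc ℓ) → VSet n) (strict : ∀ a → U (inject₁ a) ⊂ U (Fin.suc a)) where

  chain-mono : ∀ {a b} → toℕ a ℕ.≤ toℕ b → ∀ v → T (U a v) → T (U b v)
  chain-mono {a} = <-weakInduction-startingFrom (λ b → ∀ v → T (U a v) → T (U b v))
    (λ _ Uav → Uav) (λ b Ua⊆Ub v → proj₁ (strict b) v ∘ Ua⊆Ub v)

  chain-gap : ∀ {a b} → toℕ a ℕ.< toℕ b → Σ (Fin n) λ v → T (U b v) × ¬ T (U a v)
  chain-gap {a} {Fin.suc b} (ℕ.s≤s a≤b) with proj₂ (strict b)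
  ... | v , Uv , ¬Uv = v , Uv , ¬Uv ∘ chain-mono (subst (toℕ a ℕ.≤_) (sym (Finₚ.toℕ-inject₁ b)) a≤b) v

module Windows (𝔽 : OrderedField) {n : ℕ} {s t : Fin n} {x : Vec-E 𝔽 n} (feasible : Feasible 𝔽 s t x)
               {ℓ : ℕ} {U : Fin (suc ℓ) → VSet n} (chain : NarrowChain 𝔽 s t x ℓ U) where
  open OrderedField 𝔽
  open OrderedFieldProperties 𝔽
  open Weights 𝔽
  open Chain U (proj₁ (proj₂ (proj₂ chain)))
  open ≤-Reasoning

  private
    cut = proj₁ feasible
    degree = proj₁ (proj₂ feasible)
    degree-s = proj₁ (proj₂ (proj₂ feasible))
    x≥0 = proj₂ (proj₂ (proj₂ (proj₂ feasible)))

  s∈U : ∀ a → T (U a s)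
  s∈U a = chain-mono ℕ.z≤n s (subst T (sym (proj₁ chain s)) (fromWitness {a? = s Fin.≟ s} refl))

  t∉U : ∀ a → ¬ T (U a t)
  t∉U a t∈Ua = subst T (Equivalence.to T-not-≡ t∉V∖t) (fromWitness {a? = t Fin.≟ t} refl)
    where
    t∉V∖t : T (not (single t t))
    t∉V∖t = subst T (proj₁ (proj₂ chain) t) (chain-mono (Finₚ.≤fromℕ a) t t∈Ua)

  diff-window : ∀ {h i M} → toℕ h ℕ.< toℕ i → (∀ v → M v ≡ (U i v ∧ not (U h v))) →
    NonEmpty M × DeficitAtMost x M (wt 𝔽 x (δ (U h)) + wt 𝔽 x (δ (U i)))
  diff-window {h} {i} {M} h<i M≡ with chain-gap h<i
  ... | v , Uiv , ¬Uhv = (v , v∈M) , deficit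
    where
    v∈M : T (M v)
    v∈M = subst T (sym (M≡ v)) (Equivalence.from T-∧ (Uiv , Equivalence.from T-not-≡ (¬T⇒≡false ¬Uhv)))
    Y = wt 𝔽 x (Einside M)
    D = wt 𝔽 x (δ M)
    s∉M : M s ≡ false
    s∉M = trans (M≡ s) (trans (cong (λ b → U i s ∧ not b) (Equivalence.to T-≡ (s∈U h))) (∧-zeroʳ (U i s)))
    t∉M : ¬ T (M t)
    t∉M t∈M = t∉U i (proj₁ (Equivalence.to T-∧ (subst T (M≡ t) t∈M)))
    δM⊆ : ∀ u w → T (δ M u w) → T (δ (U h) u w) ⊎ T (δ (U i) u w)
    δM⊆ u w = δ-diff⊆δ∪δ (U h u) (U i u) (U h w) (U i w) ∘ subst T (cong₂ _xor_ (M≡ u) (M≡ w))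
    deficit : DeficitAtMost x M (wt 𝔽 x (δ (U h)) + wt 𝔽 x (δ (U i)))
    deficit = begin
      ιℕ (size M) + ιℕ (size M) ≡⟨ sym (inside-degrees M degree degree-s t∉M) ⟩
      Y + Y + D + ind (M s)     ≡⟨ cong (λ b → Y + Y + D + ind b) s∉M ⟩
      Y + Y + D + 0#            ≡⟨ +-identityʳ (Y + Y + D) ⟩
      Y + Y + D                 ≤⟨ +-monoʳ-≤ (Y + Y) (wt-mono-∪ x≥0 δM⊆) ⟩
      Y + Y + (wt 𝔽 x (δ (U h)) + wt 𝔽 x (δ (U i))) ∎

  prefix-window : ∀ {i M} → (∀ v → M v ≡ U i v) →
    NonEmpty M × DeficitAtMost x M (wt 𝔽 x (δ (U i)) + wt 𝔽 x (δ (U i)))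
  prefix-window {i} {M} M≡ = (s , s∈M) , deficit
    where
    Y = wt 𝔽 x (Einside M)
    B = wt 𝔽 x (δ (U i))
    s∈M : T (M s)
    s∈M = subst T (sym (M≡ s)) (s∈U i)
    t∉M : ¬ T (M t)
    t∉M t∈M = t∉U i (subst T (M≡ t) t∈M)
    1≤B : 1# ≤ B
    1≤B = subst (_≤ B) (cong₂ (λ a b → if a xor b then 1# else 2#) (Equivalence.to T-≡ (s∈U i))
                                                                (¬T⇒≡false (t∉U i)))
                (cut (U i) (s , s∈U i) (t , t∉U i))
    δM≡δUi : ∀ u w → δ M u w ≡ δ (U i) u w
    δM≡δUi u w = cong₂ _xor_ (M≡ u) (M≡ w)
    deficit : DeficitAtMost x M (B + B)
    deficit = begin
      ιℕ (size M) + ιℕ (size M)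
        ≡⟨ sym (inside-degrees M degree degree-s t∉M) ⟩
      Y + Y + wt 𝔽 x (δ M) + ind (M s)
        ≡⟨ cong₂ (λ d b → Y + Y + d + ind b) (wt-cong x δM≡δUi) (Equivalence.to T-≡ s∈M) ⟩
      Y + Y + B + 1#
        ≤⟨ +-monoʳ-≤ (Y + Y + B) 1≤B ⟩
      Y + Y + B + B
        ≡⟨ +-assoc (Y + Y) B B ⟩
      Y + Y + (B + B) ∎

module Connectivity (𝔽 : CeilField) where
  open CeilField 𝔽
  open OrderedFieldProperties ordered
  open CeilFieldProperties 𝔽
  open Weights ordered

  -- toℕ j is the paper's j − 1, so the two ceiling hypotheses say toℕ j < r(2 − A − ε), r(2 − B − ε).
  window-connected : ∀ {n r} {x : Vec-E ordered n} {S : Fin r → EdgeSet n} {M : VSet n} {ε A B : K} →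
    (∀ k → ¬ HasCycle (S k)) → wt ordered x (Einside M) - ε ≤ wt ordered (avg ordered S) (Einside M) →
    (j : Fin r) → + suc (toℕ j) ℤ.≤ ⌈ ιℕ r * (2# - A - ε) ⌉ → + suc (toℕ j) ℤ.≤ ⌈ ιℕ r * (2# - B - ε) ⌉ →
    NonEmpty M → DeficitAtMost x M (A + B) →
    Σ (Fin r) λ k → toℕ j ℕ.≤ toℕ k × Connected (S k) M
  window-connected {r = r} {x} {S} {M} {ε} acyclic approx j θA θB (v₀ , Mv₀) deficit
    with Averages.connected-or-sparse ordered S M acyclic Mv₀ j
  ... | inj₁ found  = found
  ... | inj₂ sparse = ⊥-elim (sparsity-contradiction (0≤ιℕ r)
      (+suc≤⌈⌉⇒ιℕ< (toℕ j) θA) (+suc≤⌈⌉⇒ιℕ< (toℕ j) θB) deficit Y≤X+ε sparse)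
    where
    Y≤X+ε : wt ordered x (Einside M) ≤ wt ordered (avg ordered S) (Einside M) + ε
    Y≤X+ε = subst (_≤ _) (a-b+b≡a _ ε) (+-monoˡ-≤ _ _ ε approx)

lemma5 : (𝔽 : CeilField) → let open CeilField 𝔽 in
    {n : ℕ} (s t : Fin n) → s ≢ t →
    (c : Fin n → Fin n → K) → IsMetric ordered c →
    (xs : Vec-E ordered n) → Optimal ordered c s t xs →
    (ℓ : ℕ) (U : Fin (suc ℓ) → VSet n) → NarrowChain ordered s t xs ℓ U →
    {r : ℕ} (S : Fin r → EdgeSet n) → (∀ j → IsSpanningTree (S j)) →
    (ε : K) → 0# ≤ ε →
    wt ordered (avg ordered S) (δ (single s)) ≡ 1# →
    wt ordered (avg ordered S) (δ (single t)) ≡ 1# →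
    (∀ (F : EdgeSet n) → (wt ordered xs F - ε ≤ wt ordered (avg ordered S) F)
                        × (wt ordered (avg ordered S) F ≤ wt ordered xs F + ε)) →
    (h i : Fin (suc ℓ)) → toℕ h ℕ.< toℕ i →
    (j : Fin r) →
    + suc (toℕ j) ℤ.≤ ⌈ ιℕ r * (2# - wt ordered xs (δ (U h)) - ε) ⌉ →
    + suc (toℕ j) ℤ.≤ ⌈ ιℕ r * (2# - wt ordered xs (δ (U i)) - ε) ⌉ →
    (M : VSet n) →
    ((∀ v → M v ≡ (U i v ∧ not (U h v))) ⊎ (∀ v → M v ≡ U i v)) →
    Σ (Fin r) λ k → toℕ j ℕ.≤ toℕ k × Connected (S k) M
-- Only feasibility of x*, the chain structure of the narrow cuts and x*(F) − ε ≤ x(F) are needed.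
lemma5 𝔽 s t _ _ _ xs (feasible , _) ℓ U chain S trees ε _ _ _ approx h i h<i j θh θi M window =
  [ uncurry (window-connected acyclic lower j θh θi) ∘ diff-window h<i
  , uncurry (window-connected acyclic lower j θi θi) ∘ prefix-window
  ]′ window
  where
  open Connectivity 𝔽
  open Windows (CeilField.ordered 𝔽) feasible {U = U} chain
  acyclic = proj₂ ∘ trees
  lower = proj₁ (approx (Einside M))
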